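{- For every symmetric Boolean function $f:\{0,1\}^n\to\{0,1\}$ there is an NN representation of $f$ with $I(f)$ anchors whose anchor matrix $A\in\mathbb{Q}^{I(f)\times n}$ satisfies $RES(A)=O(\log n)$.
   Context: $|X|$ is the number of ones of $X\in\{0,1\}^n$; $d$ is Euclidean distance. $f$ is symmetric if $f(X)$ depends only on $|X|$. The intervals of $f$ are the maximal sets of consecutive integers in $\{0,\dots,n\}$ on which $f$ (as a function of $|X|$) is constant, and $I(f)$ is their number. An NN representation of $f$ is a pair of disjoint finite sets $P,N\subset\mathbb{R}^n$ (anchors) such that for every $X$ with $f(X)=1$ there is $p\in P$ with $d(X,p)<d(X,q)$ for all $q\in N$, and for every $X$ with $f(X)=0$ there is $q\in N$ with $d(X,q)<d(X,p)$ for all $p\in P$. Its anchor matrix is the matrix whose rows are the anchors. The resolution of a rational $a/b$ ($a,b\in\mathbb{Z}$ coprime, $b\ne0$) is $RES(a/b)=\lceil\max\{\log_2|a+1|,\log_2|b+1|\}\rceil$, and $RES(A)$ is the maximum resolution of the entries of $A$. -}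

module Defs where

open import Data.Bool using (Bool; true; false; if_then_else_)
open import Data.Nat as ℕ using (ℕ; zero; suc; _⊔_)
open import Data.Nat.Logarithm using (⌈log₂_⌉)
open import Data.Fin using (Fin; toℕ)
open import Data.Vec using (Vec; []; _∷_; tabulate; foldr; zipWith; count)
open import Data.Integer as ℤ using (ℤ; ∣_∣)
open import Data.Rational as ℚ using (ℚ; 0ℚ; 1ℚ)
open import Data.List using (List; length)
open import Data.List.Membership.Propositional using (_∈_; _∉_)
open import Data.List.Relation.Unary.Unique.Propositional using (Unique)
open import Data.Product using (_×_; ∃; ∃-syntax; Σ-syntax)
open import Relation.Binary.PropositionalEquality using (_≡_; _≢_)
open import Relation.Nullary using (Dec; yes; no)
open import Relation.Nullary.Decidable using (⌊_⌋)

BoolFun : ℕ → Set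
BoolFun n = Vec Bool n → Bool

weight : ∀ {n} → Vec Bool n → ℕ
weight X = count (λ b → b Data.Bool.≟ true) X

Symmetric : ∀ {n} → BoolFun n → Set
Symmetric {n} f = ∀ (X Y : Vec Bool n) → weight X ≡ weight Y → f X ≡ f Y

-- the input 1^k 0^(n-k)  (has exactly k ones when k ≤ n)
onesFirst : (n k : ℕ) → Vec Bool n
onesFirst n k = tabulate (λ i → toℕ i ℕ.<ᵇ k)

changes : (ℕ → Bool) → ℕ → ℕ
changes g zero = 0
changes g (suc m) with g m Data.Bool.≟ g (suc m)
... | yes _ = changes g m
... | no  _ = suc (changes g m)

-- I(f): number of maximal constant intervals of k ↦ f(|X| = k) on {0,…,n}
-- = 1 + number of positions k < n where the value changes between k and k+1.
I : ∀ {n} → BoolFun n → ℕ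
I {n} f = suc (changes (λ k → f (onesFirst n k)) n)

toℚ : Bool → ℚ
toℚ true  = 1ℚ
toℚ false = 0ℚ

-- squared Euclidean distance (d(X,p) < d(X,q) iff d²(X,p) < d²(X,q))
dist² : ∀ {n} → Vec ℚ n → Vec ℚ n → ℚ
dist² x y = foldr _ ℚ._+_ 0ℚ (zipWith (λ a b → (a ℚ.- b) ℚ.* (a ℚ.- b)) x y)

embed : ∀ {n} → Vec Bool n → Vec ℚ n
embed = Data.Vec.map toℚ

-- NN representation of f by (finite) anchor sets P (label 1) and N (label 0),
-- given as duplicate-free lists, disjoint from each other.
record NNRep {n : ℕ} (f : BoolFun n) (P N : List (Vec ℚ n)) : Set where
  field
    uniqueP  : Unique P
    uniqueN  : Unique N
    disjoint : ∀ {p} → p ∈ P → p ∉ N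
    pos : ∀ X → f X ≡ true  →
            ∃[ p ] (p ∈ P × (∀ q → q ∈ N → dist² (embed X) p ℚ.< dist² (embed X) q))
    neg : ∀ X → f X ≡ false →
            ∃[ q ] (q ∈ N × (∀ p → p ∈ P → dist² (embed X) q ℚ.< dist² (embed X) p))

-- RES(a/b) = ⌈max(log₂|a+1|, log₂|b+1|)⌉ with a/b in lowest terms, b > 0
-- (ceiling commutes with max, so this is the max of the two ceilings).
RES : ℚ → ℕ
RES r = ⌈log₂ ∣ ℚ.↥ r ℤ.+ ℤ.1ℤ ∣ ⌉ ⊔ ⌈log₂ suc (ℚ.↧ₙ r) ⌉

-- RES(A) ≤ k : every entry of every anchor (row of the anchor matrix) has resolution ≤ k
RESBound : ∀ {n} → List (Vec ℚ n) → ℕ → Set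
RESBound A k = ∀ {a} → a ∈ A → ∀ (i : Fin _) → RES (Data.Vec.lookup a i) ℕ.≤ k

{-# OPTIONS --safe #-}
-- Write g k = f(1ᵏ0ⁿ⁻ᵏ), ι a for the number of changes of g below a, and S a for the sum of
-- 2j + 1 over the change points j < a; there is one anchor per constant interval of g.
-- For a fixed weight w, φ(a) = S a − 2w · ι a only moves at change points j, by 2j + 1 − 2w,
-- so it is smallest exactly on the interval containing w.  The anchor of an interval is
-- ι · (1, …, 1) + (σ / K)(e₀ − e₁) with σ = K²/4 + S + n³ − n ι²: K² times its squared distance
-- to X is a term not depending on the anchor, plus K² φ(a), plus an error that varies by less
-- than K² when K = 8(1 + n + n² + n³).  Numerators and denominators are then O(n⁶), so the
-- resolution is O(log n).
module Submission where

open import Defs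
open import Data.Bool using (Bool; true; false)
import Data.Bool as Bool
open import Data.Nat as ℕ using (ℕ; zero; suc; z≤n; s≤s)
import Data.Nat.Properties as ℕP
open import Data.List as List using (List; []; _∷_; _++_; [_]; length; filter)
import Data.List.Properties as ListP
open import Data.List.Membership.Propositional using (_∈_; _∉_)
import Data.List.Membership.Propositional.Properties as ∈P
open import Data.List.Relation.Unary.Any using (here; there)
open import Data.List.Relation.Unary.Unique.Propositional using (Unique)
import Data.List.Relation.Unary.Unique.Propositional.Properties as UniqueP
open import Data.List.Relation.Unary.AllPairs using ([]; _∷_)
import Data.List.Relation.Unary.All as All
open All using ([])
open import Data.Product using (∃-syntax; _×_; _,_; proj₁; proj₂)
open import Data.Sum using (inj₁; inj₂)
open import Data.Empty using (⊥-elim)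
open import Data.Vec using (Vec; []; _∷_)
open import Relation.Binary.Definitions using (tri<; tri≈; tri>)
open import Relation.Binary.PropositionalEquality hiding ([_])
open import Relation.Nullary using (yes; no)

Unique-map⁺-on : ∀ {A C : Set} (f : A → C) {xs : List A} →
                 (∀ {a b} → a ∈ xs → b ∈ xs → f a ≡ f b → a ≡ b) → Unique xs → Unique (List.map f xs)
Unique-map⁺-on f {[]}     _   []           = []
Unique-map⁺-on f {x ∷ xs} inj (x∉ ∷ uniq) =
  All.tabulate fresh ∷ Unique-map⁺-on f (λ a∈ b∈ → inj (there a∈) (there b∈)) uniq
  where
  fresh : ∀ {y} → y ∈ List.map f xs → f x ≢ y
  fresh y∈ fx≡y with ∈P.∈-map⁻ f y∈
  ... | b , b∈ , refl = All.lookup x∉ b∈ (inj (here refl) (there b∈) fx≡y)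

length-filter-true+false : (g : ℕ → Bool) (xs : List ℕ) →
  length (filter (λ a → g a Bool.≟ true) xs) ℕ.+ length (filter (λ a → g a Bool.≟ false) xs) ≡ length xs
length-filter-true+false g [] = refl
length-filter-true+false g (x ∷ xs) with g x
... | true  = cong suc (length-filter-true+false g xs)
... | false = trans (ℕP.+-suc _ _) (cong suc (length-filter-true+false g xs))

weight-≤ : ∀ {n} (X : Vec Bool n) → weight X ℕ.≤ n
weight-≤ []          = z≤n
weight-≤ (true  ∷ X) = s≤s (weight-≤ X)
weight-≤ (false ∷ X) = ℕP.m≤n⇒m≤1+n (weight-≤ X)

weight-onesFirst : ∀ {n k} → k ℕ.≤ n → weight (onesFirst n k) ≡ k
weight-onesFirst {zero}  z≤n       = refl
weight-onesFirst {suc n} z≤n       = weight-onesFirst {n} z≤n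
weight-onesFirst {suc n} (s≤s k≤n) = cong suc (weight-onesFirst k≤n)

record Admissible (n s i : ℕ) : Set where
  field
    index-≤ : i ℕ.≤ n
    sum-≤   : s ℕ.≤ n ℕ.* n
    -- With fewer than two coordinates the anchor cannot be tilted, so s must be n i² exactly.
    narrow  : n ℕ.≤ 1 → s ≡ n ℕ.* (i ℕ.* i)

module Intervals (g : ℕ → Bool) where

  open import Data.Nat using (_+_; _*_; _≤_; _<_)
  open import Data.Nat.Tactic.RingSolver using (solve-∀)

  changeSum : ℕ → ℕ
  changeSum zero = 0
  changeSum (suc m) with g m Bool.≟ g (suc m)
  ... | yes _ = changeSum m
  ... | no  _ = changeSum m + suc (2 * m)

  starts : ℕ → List ℕ
  starts zero = [ 0 ]
  starts (suc m) with g m Bool.≟ g (suc m)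
  ... | yes _ = starts m
  ... | no  _ = starts m ++ [ suc m ]

  length-starts : ∀ m → length (starts m) ≡ suc (changes g m)
  length-starts zero = refl
  length-starts (suc m) with g m Bool.≟ g (suc m)
  ... | yes _ = length-starts m
  ... | no  _ = begin
    length (starts m ++ [ suc m ]) ≡⟨ ListP.length-++ (starts m) ⟩
    length (starts m) + 1          ≡⟨ cong (_+ 1) (length-starts m) ⟩
    suc (changes g m) + 1          ≡⟨ ℕP.+-comm (suc (changes g m)) 1 ⟩
    suc (suc (changes g m))        ∎
    where open ≡-Reasoning

  changes-≤ : ∀ m → changes g m ≤ m
  changes-≤ zero = z≤n
  changes-≤ (suc m) with g m Bool.≟ g (suc m)
  ... | yes _ = ℕP.m≤n⇒m≤1+n (changes-≤ m)
  ... | no  _ = s≤s (changes-≤ m)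

  changes-mono : ∀ {a b} → a ≤ b → changes g a ≤ changes g b
  changes-mono {a} {b} a≤b = helper (ℕP.≤⇒≤′ a≤b)
    where
    helper : ∀ {b} → a ℕ.≤′ b → changes g a ≤ changes g b
    helper ℕ.≤′-refl = ℕP.≤-refl
    helper (ℕ.≤′-step {b} a≤′b) with g b Bool.≟ g (suc b)
    ... | yes _ = helper a≤′b
    ... | no  _ = ℕP.m≤n⇒m≤1+n (helper a≤′b)

  value-constant : ∀ {a w} → a ℕ.≤′ w → changes g a ≡ changes g w → g a ≡ g w
  value-constant ℕ.≤′-refl _ = refl
  value-constant {a} (ℕ.≤′-step {w} a≤′w) eq with g w Bool.≟ g (suc w)
  ... | yes g≡ = trans (value-constant a≤′w eq) g≡
  ... | no  _  = ⊥-elim (ℕP.<-irrefl refl (subst (_≤ changes g w) eq (changes-mono (ℕP.≤′⇒≤ a≤′w))))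

  changes≡⇒g≡ : ∀ a w → changes g a ≡ changes g w → g a ≡ g w
  changes≡⇒g≡ a w eq with ℕP.≤-total a w
  ... | inj₁ a≤w = value-constant (ℕP.≤⇒≤′ a≤w) eq
  ... | inj₂ w≤a = sym (value-constant (ℕP.≤⇒≤′ w≤a) (sym eq))

  changeSum-≤ : ∀ m → changeSum m ≤ m * m
  changeSum-≤ zero = z≤n
  changeSum-≤ (suc m) with g m Bool.≟ g (suc m)
  ... | yes _ = ℕP.≤-trans (changeSum-≤ m) (ℕP.*-mono-≤ (ℕP.n≤1+n m) (ℕP.n≤1+n m))
  ... | no  _ = ℕP.≤-trans (ℕP.+-monoˡ-≤ (suc (2 * m)) (changeSum-≤ m)) (ℕP.≤-reflexive (square-suc m))
    where
    square-suc : ∀ m → m * m + suc (2 * m) ≡ suc m * suc m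
    square-suc = solve-∀

  -- With φ_w(a) = changeSum a − 2 w · changes g a, Minimal w a says φ_w(w) ≤ φ_w(a),
  -- strictly when a and w lie in different intervals.
  Minimal : ℕ → ℕ → Set
  Minimal w a =
    changeSum w + 2 * changes g a * w ≤ changeSum a + 2 * changes g w * w ×
    (changes g a ≢ changes g w → changeSum w + 2 * changes g a * w < changeSum a + 2 * changes g w * w)

  minimal-refl : ∀ w → Minimal w w
  minimal-refl w = ℕP.≤-refl , λ ι≢ι → ⊥-elim (ι≢ι refl)

  private
    shift : ∀ s i w → s + 2 * suc i * w ≡ (s + 2 * i * w) + 2 * w
    shift = solve-∀

    insert : ∀ s m t → s + suc (2 * m) + t ≡ (s + t) + suc (2 * m)
    insert = solve-∀

    double-suc : ∀ a → 2 * suc a ≡ suc (suc (2 * a))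
    double-suc = solve-∀

  -- A change point a moves φ_w by 2a + 1 − 2w, which is positive above w and negative below it.
  minimal-step-up : ∀ {w a} → w ≤ a → Minimal w a → Minimal w (suc a)
  minimal-step-up {w} {a} w≤a (le , lt) with g a Bool.≟ g (suc a)
  ... | yes _ = le , lt
  ... | no  _ = ℕP.<⇒≤ strict , λ _ → strict
    where
    strict : changeSum w + 2 * suc (changes g a) * w < changeSum a + suc (2 * a) + 2 * changes g w * w
    strict = subst₂ _<_ (sym (shift (changeSum w) (changes g a) w)) (sym (insert (changeSum a) a _))
               (ℕP.+-mono-≤-< le (s≤s (ℕP.*-monoʳ-≤ 2 w≤a)))

  minimal-step-down : ∀ {w a} → a < w → Minimal w (suc a) → Minimal w a
  minimal-step-down {w} {a} a<w (le , lt) with g a Bool.≟ g (suc a)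
  ... | yes _ = le , lt
  ... | no  _ = ℕP.<⇒≤ strict , λ _ → strict
    where
    odd<even : suc (2 * a) < 2 * w
    odd<even = subst (_≤ 2 * w) (double-suc a) (ℕP.*-monoʳ-≤ 2 a<w)
    strict : changeSum w + 2 * changes g a * w < changeSum a + 2 * changes g w * w
    strict = ℕP.+-cancelʳ-< (suc (2 * a)) _ _ (ℕP.<-≤-trans
      (ℕP.+-monoʳ-< (changeSum w + 2 * changes g a * w) odd<even)
      (subst₂ _≤_ (shift (changeSum w) (changes g a) w) (insert (changeSum a) a _) le))

  minimal-above : ∀ d w → Minimal w (d + w)
  minimal-above zero    w = minimal-refl w
  minimal-above (suc d) w = minimal-step-up (ℕP.m≤n+m w d) (minimal-above d w)

  minimal-below : ∀ d a → Minimal (d + a) a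
  minimal-below zero    a = minimal-refl a
  minimal-below (suc d) a = minimal-step-down (s≤s (ℕP.m≤n+m a d))
    (subst (λ w → Minimal w (suc a)) (ℕP.+-suc d a) (minimal-below d (suc a)))

  minimal : ∀ w a → Minimal w a
  minimal w a with ℕP.≤-total w a
  ... | inj₁ w≤a = subst (Minimal w) (ℕP.m∸n+n≡m w≤a) (minimal-above (a ℕ.∸ w) w)
  ... | inj₂ a≤w = subst (λ v → Minimal v a) (ℕP.m∸n+n≡m a≤w) (minimal-below (w ℕ.∸ a) a)

  starts-mono : ∀ {a m} → a ∈ starts m → a ∈ starts (suc m)
  starts-mono {m = m} a∈ with g m Bool.≟ g (suc m)
  ... | yes _ = a∈
  ... | no  _ = ∈P.∈-++⁺ˡ a∈

  starts-mono-≤ : ∀ {a m m′} → m ≤ m′ → a ∈ starts m → a ∈ starts m′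
  starts-mono-≤ m≤m′ a∈ = helper (ℕP.≤⇒≤′ m≤m′)
    where
    helper : ∀ {m′} → _ ℕ.≤′ m′ → _ ∈ starts m′
    helper ℕ.≤′-refl        = a∈
    helper (ℕ.≤′-step m≤′m′) = starts-mono (helper m≤′m′)

  starts-≤ : ∀ {a} m → a ∈ starts m → a ≤ m
  starts-≤ zero (here refl) = z≤n
  starts-≤ (suc m) a∈ with g m Bool.≟ g (suc m)
  ... | yes _ = ℕP.m≤n⇒m≤1+n (starts-≤ m a∈)
  ... | no  _ with ∈P.∈-++⁻ (starts m) a∈
  ...   | inj₁ a∈′       = ℕP.m≤n⇒m≤1+n (starts-≤ m a∈′)
  ...   | inj₂ (here refl) = ℕP.≤-refl

  changes-step : ∀ {m} → g m ≢ g (suc m) → changes g (suc m) ≡ suc (changes g m)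
  changes-step {m} g≢ with g m Bool.≟ g (suc m)
  ... | yes g≡ = ⊥-elim (g≢ g≡)
  ... | no  _  = refl

  changeSum-step : ∀ {m} → g m ≢ g (suc m) → changeSum (suc m) ≡ changeSum m + suc (2 * m)
  changeSum-step {m} g≢ with g m Bool.≟ g (suc m)
  ... | yes g≡ = ⊥-elim (g≢ g≡)
  ... | no  _  = refl

  changes-<-starts : ∀ {a b} m → b ∈ starts m → a < b → changes g a < changes g b
  changes-<-starts zero (here refl) ()
  changes-<-starts (suc m) b∈ a<b with g m Bool.≟ g (suc m)
  ... | yes _ = changes-<-starts m b∈ a<b
  ... | no g≢ with ∈P.∈-++⁻ (starts m) b∈
  ...   | inj₁ b∈′        = changes-<-starts m b∈′ a<b
  ...   | inj₂ (here refl) = subst (_ <_) (sym (changes-step g≢)) (s≤s (changes-mono (ℕP.≤-pred a<b)))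

  changes-injective-starts : ∀ {a b} m → a ∈ starts m → b ∈ starts m →
                             changes g a ≡ changes g b → a ≡ b
  changes-injective-starts {a} {b} m a∈ b∈ eq with ℕP.<-cmp a b
  ... | tri< a<b _ _ = ⊥-elim (ℕP.<-irrefl eq (changes-<-starts m b∈ a<b))
  ... | tri≈ _ a≡b _ = a≡b
  ... | tri> _ _ b<a = ⊥-elim (ℕP.<-irrefl (sym eq) (changes-<-starts m a∈ b<a))

  starts-unique : ∀ m → Unique (starts m)
  starts-unique zero = [] ∷ []
  starts-unique (suc m) with g m Bool.≟ g (suc m)
  ... | yes _ = starts-unique m
  ... | no  _ = UniqueP.++⁺ (starts-unique m) ([] ∷ []) λ where
    (a∈ , here refl) → ℕP.<-irrefl refl (starts-≤ m a∈)

  interval-start : ∀ {w m} → w ≤ m → ∃[ a ] (a ∈ starts m ×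
    changes g a ≡ changes g w × changeSum a ≡ changeSum w × g a ≡ g w)
  interval-start {zero}  w≤m = 0 , starts-mono-≤ w≤m (here refl) , refl , refl , refl
  interval-start {suc w} {m} w<m with interval-start {w} (ℕP.<⇒≤ w<m) | g w Bool.≟ g (suc w)
  ... | a , a∈ , ι≡ , S≡ , g≡ | yes gw≡ = a , a∈ , ι≡ , S≡ , trans g≡ gw≡
  ... | _                      | no  gw≢ =
    suc w , starts-mono-≤ w<m new , changes-step gw≢ , changeSum-step gw≢ , refl
    where
    new : suc w ∈ starts (suc w)
    new with g w Bool.≟ g (suc w)
    ... | yes gw≡ = ⊥-elim (gw≢ gw≡)
    ... | no  _   = ∈P.∈-++⁺ʳ (starts w) (here refl)

  admissible : ∀ {n a} → a ≤ n → Admissible n (changeSum a) (changes g a)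
  admissible {n} {a} a≤n = record
    { index-≤ = ℕP.≤-trans (changes-≤ a) a≤n
    ; sum-≤   = ℕP.≤-trans (changeSum-≤ a) (ℕP.*-mono-≤ a≤n a≤n)
    ; narrow  = λ n≤1 → changeSum-narrow n≤1 a≤n
    }
    where
    changeSum-narrow : ∀ {n a} → n ≤ 1 → a ≤ n → changeSum a ≡ n * (changes g a * changes g a)
    changeSum-narrow {zero}        {zero}        _ _ = refl
    changeSum-narrow {suc zero}    {zero}        _ _ = refl
    changeSum-narrow {suc zero}    {suc zero}    _ _ with g 0 Bool.≟ g 1
    ... | yes _ = refl
    ... | no  _ = refl
    changeSum-narrow {suc zero}    {suc (suc _)} _ (s≤s ())
    changeSum-narrow {suc (suc _)} (s≤s ()) _

module SquaredDistance where

  open import Data.Integer using (ℤ; +_; -_; _+_; _*_; _-_; _≤_; ∣_∣; +≤+; -≤+; -≤-)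
  import Data.Integer.Properties as ℤP
  open import Data.Integer.Tactic.RingSolver using (solve-∀)
  open import Data.Fin using (Fin; zero; suc)
  open import Data.Vec using (replicate; lookup)
  import Data.Vec.Properties as VecP

  bit : Bool → ℤ
  bit true  = + 1
  bit false = + 0

  -- K² times the squared distance between X and e / K.
  sqDist : ∀ {n} → ℤ → Vec Bool n → Vec ℤ n → ℤ
  sqDist K []      []       = + 0
  sqDist K (x ∷ X) (e ∷ es) = (K * bit x - e) * (K * bit x - e) + sqDist K X es

  dot : ∀ {n} → Vec Bool n → Vec ℤ n → ℤ
  dot []      []       = + 0
  dot (x ∷ X) (e ∷ es) = bit x * e + dot X es

  norm² : ∀ {n} → Vec ℤ n → ℤ
  norm² []       = + 0
  norm² (e ∷ es) = e * e + norm² es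

  weight-∷ : ∀ {n} x (X : Vec Bool n) → + weight (x ∷ X) ≡ bit x + + weight X
  weight-∷ true  X = refl
  weight-∷ false X = refl

  bit-idem : ∀ x → bit x * bit x ≡ bit x
  bit-idem true  = refl
  bit-idem false = refl

  square-bit : ∀ K x e → (K * bit x - e) * (K * bit x - e) ≡ K * K * bit x - + 2 * K * (bit x * e) + e * e
  square-bit K x e = begin
    (K * bit x - e) * (K * bit x - e)                      ≡⟨ square-diff K (bit x) e ⟩
    K * K * (bit x * bit x) - + 2 * K * (bit x * e) + e * e
      ≡⟨ cong (λ b → K * K * b - + 2 * K * (bit x * e) + e * e) (bit-idem x) ⟩
    K * K * bit x - + 2 * K * (bit x * e) + e * e           ∎
    where
    open ≡-Reasoning
    square-diff : ∀ K b e → (K * b - e) * (K * b - e) ≡ K * K * (b * b) - + 2 * K * (b * e) + e * e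
    square-diff = solve-∀

  sqDist-expand : ∀ {n} K (X : Vec Bool n) e →
                  sqDist K X e ≡ K * K * + weight X - + 2 * K * dot X e + norm² e
  sqDist-expand K []      []       = sym (vanish K)
    where
    vanish : ∀ K → K * K * + 0 - + 2 * K * + 0 + + 0 ≡ + 0
    vanish = solve-∀
  sqDist-expand K (x ∷ X) (e ∷ es) = begin
    (K * bit x - e) * (K * bit x - e) + sqDist K X es
      ≡⟨ cong₂ _+_ (square-bit K x e) (sqDist-expand K X es) ⟩
    K * K * bit x - + 2 * K * (bit x * e) + e * e + (K * K * + weight X - + 2 * K * dot X es + norm² es)
      ≡⟨ regroup (K * K) (+ 2 * K) (bit x) (+ weight X) (bit x * e) (dot X es) (e * e) (norm² es) ⟩
    K * K * (bit x + + weight X) - + 2 * K * (bit x * e + dot X es) + (e * e + norm² es)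
      ≡⟨ cong (λ w → K * K * w - + 2 * K * (bit x * e + dot X es) + (e * e + norm² es)) (sym (weight-∷ x X)) ⟩
    K * K * + weight (x ∷ X) - + 2 * K * dot (x ∷ X) (e ∷ es) + norm² (e ∷ es) ∎
    where
    open ≡-Reasoning
    regroup : ∀ a b w v d d′ q q′ →
              a * w - b * d + q + (a * v - b * d′ + q′) ≡ a * (w + v) - b * (d + d′) + (q + q′)
    regroup = solve-∀

  dot-replicate : ∀ {n} (X : Vec Bool n) c → dot X (replicate n c) ≡ c * + weight X
  dot-replicate []      c = sym (ℤP.*-zeroʳ c)
  dot-replicate (x ∷ X) c = begin
    bit x * c + dot X (replicate _ c) ≡⟨ cong (λ d → bit x * c + d) (dot-replicate X c) ⟩
    bit x * c + c * + weight X         ≡⟨ factor (bit x) c (+ weight X) ⟩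
    c * (bit x + + weight X)           ≡⟨ cong (c *_) (sym (weight-∷ x X)) ⟩
    c * + weight (x ∷ X)               ∎
    where
    open ≡-Reasoning
    factor : ∀ b c w → b * c + c * w ≡ c * (b + w)
    factor = solve-∀

  norm²-replicate : ∀ n c → norm² (replicate n c) ≡ + n * (c * c)
  norm²-replicate zero    c = sym (ℤP.*-zeroˡ (c * c))
  norm²-replicate (suc n) c = trans (cong (λ q → c * c + q) (norm²-replicate n c)) (factor (+ n) (c * c))
    where
    factor : ∀ n q → q + n * q ≡ (+ 1 + n) * q
    factor = solve-∀

  sqDist-replicate : ∀ {n} K (X : Vec Bool n) c →
    sqDist K X (replicate n c) ≡ K * K * + weight X - + 2 * K * (c * + weight X) + + n * (c * c)
  sqDist-replicate {n} K X c = trans (sqDist-expand K X _)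
    (cong₂ (λ d q → K * K * + weight X - + 2 * K * d + q) (dot-replicate X c) (norm²-replicate n c))

  -- The tilt direction e₀ − e₁ is orthogonal to (1, …, 1), so σ changes the norm without coupling to c.
  anchorVec : (n : ℕ) → ℤ → ℤ → Vec ℤ n
  anchorVec (suc (suc k)) c σ = c + σ ∷ c - σ ∷ replicate k c
  anchorVec n             c σ = replicate n c

  tilt : ∀ {n} → Vec Bool n → ℤ
  tilt (x ∷ y ∷ _) = bit x - bit y
  tilt _           = + 0

  dot-anchorVec : ∀ {k} (X : Vec Bool (suc (suc k))) c σ →
                  dot X (anchorVec (suc (suc k)) c σ) ≡ c * + weight X + σ * tilt X
  dot-anchorVec {k} X@(x ∷ y ∷ Y) c σ = begin
    bit x * (c + σ) + (bit y * (c - σ) + dot Y (replicate k c))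
      ≡⟨ cong (λ d → bit x * (c + σ) + (bit y * (c - σ) + d)) (dot-replicate Y c) ⟩
    bit x * (c + σ) + (bit y * (c - σ) + c * + weight Y)
      ≡⟨ regroup (bit x) (bit y) (+ weight Y) c σ ⟩
    c * (bit x + (bit y + + weight Y)) + σ * tilt X
      ≡⟨ cong (λ w → c * w + σ * tilt X)
              (sym (trans (weight-∷ x (y ∷ Y)) (cong (λ w → bit x + w) (weight-∷ y Y)))) ⟩
    c * + weight X + σ * tilt X ∎
    where
    open ≡-Reasoning
    regroup : ∀ a b w c σ → a * (c + σ) + (b * (c - σ) + c * w) ≡ c * (a + (b + w)) + σ * (a - b)
    regroup = solve-∀

  norm²-anchorVec : ∀ k c σ → norm² (anchorVec (suc (suc k)) c σ) ≡ + suc (suc k) * (c * c) + + 2 * (σ * σ)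
  norm²-anchorVec k c σ =
    trans (cong (λ q → (c + σ) * (c + σ) + ((c - σ) * (c - σ) + q)) (norm²-replicate k c)) (regroup (+ k) c σ)
    where
    regroup : ∀ k c σ → (c + σ) * (c + σ) + ((c - σ) * (c - σ) + k * (c * c)) ≡ (+ 2 + k) * (c * c) + + 2 * (σ * σ)
    regroup = solve-∀

  sqDist-wide : ∀ {k} K (X : Vec Bool (suc (suc k))) c σ →
    sqDist K X (anchorVec (suc (suc k)) c σ)
      ≡ K * K * + weight X - + 2 * K * (c * + weight X + σ * tilt X) + (+ suc (suc k) * (c * c) + + 2 * (σ * σ))
  sqDist-wide {k} K X c σ = trans (sqDist-expand K X _)
    (cong₂ (λ d q → K * K * + weight X - + 2 * K * d + q) (dot-anchorVec X c σ) (norm²-anchorVec k c σ))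

  ∣anchorVec∣≤ : ∀ {n} c σ (j : Fin n) → ∣ lookup (anchorVec n c σ) j ∣ ℕ.≤ ∣ c ∣ ℕ.+ ∣ σ ∣
  ∣anchorVec∣≤ {suc zero}    c σ zero             = ℕP.m≤m+n ∣ c ∣ ∣ σ ∣
  ∣anchorVec∣≤ {suc (suc k)} c σ zero             = ℤP.∣i+j∣≤∣i∣+∣j∣ c σ
  ∣anchorVec∣≤ {suc (suc k)} c σ (suc zero)       = ℤP.∣i-j∣≤∣i∣+∣j∣ c σ
  ∣anchorVec∣≤ {suc (suc k)} c σ (suc (suc j))    =
    subst (λ e → ∣ e ∣ ℕ.≤ ∣ c ∣ ℕ.+ ∣ σ ∣) (sym (VecP.lookup-replicate j c)) (ℕP.m≤m+n ∣ c ∣ ∣ σ ∣)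

  tilt-bounds : ∀ {n} (X : Vec Bool n) → - + 1 ≤ tilt X × tilt X ≤ + 1
  tilt-bounds []                  = -≤+ , +≤+ z≤n
  tilt-bounds (_ ∷ [])            = -≤+ , +≤+ z≤n
  tilt-bounds (true  ∷ true  ∷ _) = -≤+ , +≤+ z≤n
  tilt-bounds (true  ∷ false ∷ _) = -≤+ , +≤+ (s≤s z≤n)
  tilt-bounds (false ∷ true  ∷ _) = -≤- z≤n , -≤+
  tilt-bounds (false ∷ false ∷ _) = -≤+ , +≤+ z≤n

module IntegerOrder where

  open import Data.Integer using (ℤ; +_; _+_; _*_; _-_; _≤_; _<_; nonNegative)
  import Data.Integer.Properties as ℤP
  open import Data.Integer.Tactic.RingSolver using (solve-∀)

  0≤i*j : ∀ {i j} → + 0 ≤ i → + 0 ≤ j → + 0 ≤ i * j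
  0≤i*j {i} {j} 0≤i 0≤j = subst (_≤ i * j) (ℤP.*-zeroʳ i)
    (ℤP.*-monoˡ-≤-nonNeg i {{nonNegative 0≤i}} 0≤j)

  0<j-i⇒i<j : ∀ {i j} → + 0 < j - i → i < j
  0<j-i⇒i<j {i} {j} 0<j-i = subst₂ _<_ (ℤP.+-identityʳ i) (cancel i j) (ℤP.+-monoʳ-< i 0<j-i)
    where
    cancel : ∀ i j → i + (j - i) ≡ j
    cancel = solve-∀

  scaled-gap-pos : ∀ {q δ e} → + 0 ≤ q → + 0 ≤ δ - + 1 → + 0 < q + e → + 0 < q * δ + e
  scaled-gap-pos {q} {δ} {e} 0≤q 0≤δ-1 0<q+e =
    subst (+ 0 <_) (split q δ e) (ℤP.+-mono-≤-< (0≤i*j 0≤q 0≤δ-1) 0<q+e)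
    where
    split : ∀ q δ e → q * (δ - + 1) + (q + e) ≡ q * δ + e
    split = solve-∀

module Anchors (B : ℕ) where

  open import Data.Integer
    using (ℤ; +_; -_; _+_; _*_; _-_; _⊖_; _≤_; _<_; ∣_∣; +≤+; +<+)
  import Data.Nat.Tactic.RingSolver as NatSolver
  import Data.Integer.Properties as ℤP
  open import Data.Integer.Tactic.RingSolver using (solve-∀)
  open import Data.Vec using (replicate; lookup)
  open SquaredDistance
  open IntegerOrder

  K : ℕ
  K = 8 ℕ.* suc B

  Kℤ : ℤ
  Kℤ = + K

  excess : ℕ → ℕ → ℕ → ℕ
  excess n s i = s ℕ.+ n ℕ.* n ℕ.* n ℕ.∸ n ℕ.* (i ℕ.* i)

  -- With σ = K²/4 + excess, 2σ² contributes K² · excess, and n i² + excess = s + n³.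
  anchorℤ : (n : ℕ) → ℕ → ℕ → Vec ℤ n
  anchorℤ n s i = anchorVec n (Kℤ * + i) (+ 16 * (+ suc B * + suc B) + + excess n s i)

  φ : ℕ → ℕ → ℕ → ℤ
  φ w s i = + s - + 2 * + i * + w

  tiltError : ℤ → ℤ → ℤ
  tiltError m t = + 2 * (m * m) - + 2 * Kℤ * m * t

  excess-ℤ : ∀ {n s i} → i ℕ.≤ n → + excess n s i ≡ + s + + n * + n * + n - + n * (+ i * + i)
  excess-ℤ {n} {s} {i} i≤n = begin
    + (s ℕ.+ n ℕ.* n ℕ.* n ℕ.∸ n ℕ.* (i ℕ.* i))   ≡⟨ sym (ℤP.⊖-≥ dominated) ⟩
    s ℕ.+ n ℕ.* n ℕ.* n ⊖ n ℕ.* (i ℕ.* i)          ≡⟨ sym (ℤP.[+m]-[+n]≡m⊖n (s ℕ.+ n ℕ.* n ℕ.* n) (n ℕ.* (i ℕ.* i))) ⟩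
    + (s ℕ.+ n ℕ.* n ℕ.* n) - + (n ℕ.* (i ℕ.* i))  ≡⟨ cong₂ _-_ (trans (ℤP.pos-+ s _) (cong (λ c → + s + c) cube))
                                                              (trans (ℤP.pos-* n _) (cong (+ n *_) (ℤP.pos-* i i))) ⟩
    + s + + n * + n * + n - + n * (+ i * + i)       ∎
    where
    open ≡-Reasoning
    dominated : n ℕ.* (i ℕ.* i) ℕ.≤ s ℕ.+ n ℕ.* n ℕ.* n
    dominated = ℕP.≤-trans (ℕP.*-monoʳ-≤ n (ℕP.*-mono-≤ i≤n i≤n))
                  (ℕP.≤-trans (ℕP.≤-reflexive (sym (ℕP.*-assoc n n n))) (ℕP.m≤n+m _ s))
    cube : + (n ℕ.* n ℕ.* n) ≡ + n * + n * + n
    cube = trans (ℤP.pos-* (n ℕ.* n) n) (cong (_* + n) (ℤP.pos-* n n))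

  excess-≤ : ∀ {n s} i → s ℕ.≤ n ℕ.* n → n ℕ.* n ℕ.+ n ℕ.* n ℕ.* n ℕ.≤ B → excess n s i ℕ.≤ suc B
  excess-≤ {n} {s} i s≤ bound = ℕP.≤-trans (ℕP.m∸n≤m _ (n ℕ.* (i ℕ.* i)))
    (ℕP.≤-trans (ℕP.+-monoˡ-≤ _ s≤) (ℕP.m≤n⇒m≤1+n bound))

  tiltError-gap : ∀ {ma mb} t → ma ℕ.≤ suc B → mb ℕ.≤ suc B → - + 1 ≤ t → t ≤ + 1 →
                  + 0 < Kℤ * Kℤ + (tiltError (+ mb) t - tiltError (+ ma) t)
  tiltError-gap {ma} {mb} t ma≤b mb≤b -1≤t t≤1 =
    subst (+ 0 <_) (sym (regroup b (+ ma) (+ mb) t))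
      (ℤP.+-mono-<-≤ (+<+ (s≤s z≤n)) (ℤP.+-mono-≤ (double (ℤP.i≤j⇒0≤j-i square-ma≤))
        (ℤP.+-mono-≤ (double (0≤i*j {+ mb} {+ mb} (+≤+ z≤n) (+≤+ z≤n)))
          (ℤP.+-mono-≤ (0≤i*j {+ 16 * b} (+≤+ z≤n) (ℤP.i≤j⇒0≤j-i mb*t≤b))
                       (0≤i*j {+ 16 * b} (+≤+ z≤n) (ℤP.i≤j⇒0≤j-i -b≤ma*t))))))
    where
    b = + suc B
    regroup : ∀ b ma mb t →
      (+ 8 * b) * (+ 8 * b) + ((+ 2 * (mb * mb) - + 2 * (+ 8 * b) * mb * t) - (+ 2 * (ma * ma) - + 2 * (+ 8 * b) * ma * t))
      ≡ + 30 * (b * b) + (+ 2 * (b * b - ma * ma)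
        + (+ 2 * (mb * mb) + (+ 16 * b * (b - mb * t) + + 16 * b * (ma * t - - b))))
    regroup = solve-∀
    double : ∀ {i} → + 0 ≤ i → + 0 ≤ + 2 * i
    double = 0≤i*j {+ 2} (+≤+ z≤n)
    square-ma≤ : + ma * + ma ≤ b * b
    square-ma≤ = subst₂ _≤_ (ℤP.pos-* ma ma) (ℤP.pos-* (suc B) (suc B)) (+≤+ (ℕP.*-mono-≤ ma≤b ma≤b))
    mb*t≤b : + mb * t ≤ b
    mb*t≤b = ℤP.≤-trans (ℤP.*-monoˡ-≤-nonNeg (+ mb) t≤1) (subst (_≤ b) (sym (ℤP.*-identityʳ (+ mb))) (+≤+ mb≤b))
    -b≤ma*t : - b ≤ + ma * t
    -b≤ma*t = ℤP.≤-trans (ℤP.neg-mono-≤ (+≤+ ma≤b))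
      (subst (_≤ + ma * t) (trans (sym (ℤP.neg-distribʳ-* (+ ma) (+ 1))) (cong -_ (ℤP.*-identityʳ (+ ma))))
        (ℤP.*-monoˡ-≤-nonNeg (+ ma) -1≤t))

  gap-ℤ : ∀ {sa ia sb ib w} → suc (sa ℕ.+ 2 ℕ.* ib ℕ.* w) ℕ.≤ sb ℕ.+ 2 ℕ.* ia ℕ.* w →
          + 0 ≤ (φ w sb ib - φ w sa ia) - + 1
  gap-ℤ {sa} {ia} {sb} {ib} {w} gap = subst (+ 0 ≤_)
    (trans (cong₂ (λ x y → x - (+ 1 + y)) (affine sb ia) (affine sa ib)) (regroup (+ sa) (+ ia) (+ sb) (+ ib) (+ w)))
    (ℤP.i≤j⇒0≤j-i (+≤+ gap))
    where
    affine : ∀ s i → + (s ℕ.+ 2 ℕ.* i ℕ.* w) ≡ + s + + 2 * + i * + w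
    affine s i = trans (ℤP.pos-+ s _) (cong (λ x → + s + x) (trans (ℤP.pos-* (2 ℕ.* i) w) (cong (_* + w) (ℤP.pos-* 2 i))))
    regroup : ∀ sa ia sb ib w → (sb + + 2 * ia * w) - (+ 1 + (sa + + 2 * ib * w))
              ≡ ((sb - + 2 * ib * w) - (sa - + 2 * ia * w)) - + 1
    regroup = solve-∀

  wide-difference : ∀ {k sa ia sb ib} (X : Vec Bool (suc (suc k))) → ia ℕ.≤ suc (suc k) → ib ℕ.≤ suc (suc k) →
    sqDist Kℤ X (anchorℤ _ sb ib) - sqDist Kℤ X (anchorℤ _ sa ia)
      ≡ Kℤ * Kℤ * (φ (weight X) sb ib - φ (weight X) sa ia)
        + (tiltError (+ excess (suc (suc k)) sb ib) (tilt X) - tiltError (+ excess (suc (suc k)) sa ia) (tilt X))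
  wide-difference {k} {sa} {ia} {sb} {ib} X ia≤ ib≤ = begin
    sqDist Kℤ X (anchorℤ n sb ib) - sqDist Kℤ X (anchorℤ n sa ia)
      ≡⟨ cong₂ _-_ (sqDist-wide Kℤ X _ _) (sqDist-wide Kℤ X _ _) ⟩
    expanded ib (+ excess n sb ib) - expanded ia (+ excess n sa ia)
      ≡⟨ cong₂ (λ mb ma → expanded ib mb - expanded ia ma) (excess-ℤ ib≤) (excess-ℤ ia≤) ⟩
    _ ≡⟨ tilted-difference (+ suc B) W t (+ n) (+ sa) (+ ia) (+ sb) (+ ib) ⟩
    _ ≡⟨ cong₂ (λ mb ma → Kℤ * Kℤ * (φ (weight X) sb ib - φ (weight X) sa ia) + (tiltError mb t - tiltError ma t))
               (sym (excess-ℤ ib≤)) (sym (excess-ℤ ia≤)) ⟩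
    _ ∎
    where
    open ≡-Reasoning
    n = suc (suc k)
    W = + weight X
    t = tilt X
    expanded : ℕ → ℤ → ℤ
    expanded i m = Kℤ * Kℤ * W - + 2 * Kℤ * (Kℤ * + i * W + (+ 16 * (+ suc B * + suc B) + m) * t)
            + (+ n * (Kℤ * + i * (Kℤ * + i)) + + 2 * ((+ 16 * (+ suc B * + suc B) + m) * (+ 16 * (+ suc B * + suc B) + m)))
    tilted-difference : ∀ b w t n sa ia sb ib →
      let K  = + 8 * b
          ma = sa + n * n * n - n * (ia * ia)
          mb = sb + n * n * n - n * (ib * ib)
          σa = + 16 * (b * b) + ma
          σb = + 16 * (b * b) + mb
      in (K * K * w - + 2 * K * (K * ib * w + σb * t) + (n * (K * ib * (K * ib)) + + 2 * (σb * σb)))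
       - (K * K * w - + 2 * K * (K * ia * w + σa * t) + (n * (K * ia * (K * ia)) + + 2 * (σa * σa)))
       ≡ K * K * ((sb - + 2 * ib * w) - (sa - + 2 * ia * w))
         + ((+ 2 * (mb * mb) - + 2 * K * mb * t) - (+ 2 * (ma * ma) - + 2 * K * ma * t))
    tilted-difference = solve-∀

  anchorℤ-narrow : ∀ {n s} i → n ℕ.≤ 1 → anchorℤ n s i ≡ replicate n (Kℤ * + i)
  anchorℤ-narrow {zero}        i _ = refl
  anchorℤ-narrow {suc zero}    i _ = refl
  anchorℤ-narrow {suc (suc _)} i (s≤s ())

  narrow-difference : ∀ {n sa ia sb ib} (X : Vec Bool n) → n ℕ.≤ 1 →
    Admissible n sa ia → Admissible n sb ib →
    sqDist Kℤ X (anchorℤ n sb ib) - sqDist Kℤ X (anchorℤ n sa ia)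
      ≡ Kℤ * Kℤ * (φ (weight X) sb ib - φ (weight X) sa ia)
  narrow-difference {n} {sa} {ia} {sb} {ib} X n≤1 adm-a adm-b = begin
    sqDist Kℤ X (anchorℤ n sb ib) - sqDist Kℤ X (anchorℤ n sa ia)
      ≡⟨ cong₂ _-_ (cong (sqDist Kℤ X) (anchorℤ-narrow ib n≤1)) (cong (sqDist Kℤ X) (anchorℤ-narrow ia n≤1)) ⟩
    sqDist Kℤ X (replicate n (Kℤ * + ib)) - sqDist Kℤ X (replicate n (Kℤ * + ia))
      ≡⟨ cong₂ _-_ (sqDist-replicate Kℤ X _) (sqDist-replicate Kℤ X _) ⟩
    _ ≡⟨ replicate-difference Kℤ (+ weight X) (+ n) (+ ia) (+ ib) ⟩
    _ ≡⟨ cong₂ (λ s′ s → Kℤ * Kℤ * ((s′ - + 2 * + ib * + weight X) - (s - + 2 * + ia * + weight X)))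
               (sym (exact adm-b)) (sym (exact adm-a)) ⟩
    _ ∎
    where
    open ≡-Reasoning
    exact : ∀ {s i} → Admissible n s i → + s ≡ + n * (+ i * + i)
    exact {s} {i} adm = trans (cong +_ (Admissible.narrow adm n≤1))
                          (trans (ℤP.pos-* n _) (cong (+ n *_) (ℤP.pos-* i i)))
    replicate-difference : ∀ K w n ia ib →
      (K * K * w - + 2 * K * (K * ib * w) + n * (K * ib * (K * ib)))
      - (K * K * w - + 2 * K * (K * ia * w) + n * (K * ia * (K * ia)))
      ≡ K * K * ((n * (ib * ib) - + 2 * ib * w) - (n * (ia * ia) - + 2 * ia * w))
    replicate-difference = solve-∀

  nearer-narrow : ∀ {n sa ia sb ib} (X : Vec Bool n) → n ℕ.≤ 1 →
    Admissible n sa ia → Admissible n sb ib →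
    suc (sa ℕ.+ 2 ℕ.* ib ℕ.* weight X) ℕ.≤ sb ℕ.+ 2 ℕ.* ia ℕ.* weight X →
    sqDist Kℤ X (anchorℤ n sa ia) < sqDist Kℤ X (anchorℤ n sb ib)
  nearer-narrow {n} {sa} {ia} {sb} {ib} X n≤1 adm-a adm-b gap =
    0<j-i⇒i<j (subst (+ 0 <_) (sym (trans (narrow-difference X n≤1 adm-a adm-b) (sym (ℤP.+-identityʳ _))))
      (scaled-gap-pos {Kℤ * Kℤ} {φ (weight X) sb ib - φ (weight X) sa ia} (+≤+ z≤n)
                      (gap-ℤ {sa} {ia} {sb} {ib} gap) (+<+ (s≤s z≤n))))

  nearer : ∀ {n sa ia sb ib} (X : Vec Bool n) → n ℕ.* n ℕ.+ n ℕ.* n ℕ.* n ℕ.≤ B →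
           Admissible n sa ia → Admissible n sb ib →
           suc (sa ℕ.+ 2 ℕ.* ib ℕ.* weight X) ℕ.≤ sb ℕ.+ 2 ℕ.* ia ℕ.* weight X →
           sqDist Kℤ X (anchorℤ n sa ia) < sqDist Kℤ X (anchorℤ n sb ib)
  nearer {zero}        X _ adm-a adm-b gap = nearer-narrow X z≤n adm-a adm-b gap
  nearer {suc zero}    X _ adm-a adm-b gap = nearer-narrow X (s≤s z≤n) adm-a adm-b gap
  nearer {suc (suc k)} {sa} {ia} {sb} {ib} X bound adm-a adm-b gap =
    0<j-i⇒i<j (subst (+ 0 <_) (sym (wide-difference X (index-≤ adm-a) (index-≤ adm-b)))
      (scaled-gap-pos {Kℤ * Kℤ} {φ (weight X) sb ib - φ (weight X) sa ia} (+≤+ z≤n) (gap-ℤ {sa} {ia} {sb} {ib} gap)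
        (tiltError-gap (tilt X) (excess-≤ ia (sum-≤ adm-a) bound) (excess-≤ ib (sum-≤ adm-b) bound)
                       (proj₁ (tilt-bounds X)) (proj₂ (tilt-bounds X)))))
    where open Admissible

  K<32b² : K ℕ.< 32 ℕ.* (suc B ℕ.* suc B)
  K<32b² = ℕP.≤-<-trans (ℕP.*-monoʳ-≤ 8 (ℕP.m≤m*n (suc B) (suc B)))
                        (ℕP.*-monoˡ-< (suc B ℕ.* suc B) {8} {32} (ℕP.m≤m+n 9 23))

  ∣anchorℤ∣<32b² : ∀ {n s i} → Admissible n s i → n ℕ.* n ℕ.+ n ℕ.* n ℕ.* n ℕ.≤ B → n ℕ.≤ B →
                   ∀ j → ∣ lookup (anchorℤ n s i) j ∣ ℕ.< 32 ℕ.* (suc B ℕ.* suc B)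
  ∣anchorℤ∣<32b² {n} {s} {i} adm bound n≤B j = ℕP.≤-<-trans (∣anchorVec∣≤ (Kℤ * + i) _ j) (begin-strict
    ∣ Kℤ * + i ∣ ℕ.+ (16 ℕ.* (b ℕ.* b) ℕ.+ excess n s i)
      ≤⟨ ℕP.+-mono-≤ (ℕP.≤-reflexive (ℤP.abs-* Kℤ (+ i))) ℕP.≤-refl ⟩
    8 ℕ.* b ℕ.* i ℕ.+ (16 ℕ.* (b ℕ.* b) ℕ.+ excess n s i)
      ≤⟨ ℕP.+-mono-≤ (ℕP.*-monoʳ-≤ (8 ℕ.* b) i≤b)
                     (ℕP.+-monoʳ-≤ (16 ℕ.* (b ℕ.* b))
                       (ℕP.≤-trans (excess-≤ {n} i (sum-≤ adm) bound) (ℕP.m≤m*n b b))) ⟩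
    8 ℕ.* b ℕ.* b ℕ.+ (16 ℕ.* (b ℕ.* b) ℕ.+ b ℕ.* b)
      ≡⟨ collect b ⟩
    25 ℕ.* (b ℕ.* b)
      <⟨ ℕP.*-monoˡ-< (b ℕ.* b) {25} {32} (ℕP.m≤m+n 26 6) ⟩
    32 ℕ.* (b ℕ.* b) ∎)
    where
    open ℕP.≤-Reasoning
    open Admissible
    b = suc B
    i≤b : i ℕ.≤ b
    i≤b = ℕP.≤-trans (index-≤ adm) (ℕP.m≤n⇒m≤1+n n≤B)
    collect : ∀ b → 8 ℕ.* b ℕ.* b ℕ.+ (16 ℕ.* (b ℕ.* b) ℕ.+ b ℕ.* b) ≡ 25 ℕ.* (b ℕ.* b)
    collect = NatSolver.solve-∀

module Scaling where

  open import Data.Integer as ℤ using (ℤ; +_; -_; _+_; _*_; _-_)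
  import Data.Integer.Properties as ℤP
  open import Data.Integer.Tactic.RingSolver using (solve-∀)
  open import Data.Rational as ℚ using (ℚ; toℚᵘ)
  import Data.Rational.Properties as ℚP
  open import Data.Rational.Unnormalised as ℚᵘ using (mkℚᵘ; *≡*; *<*)
  import Data.Rational.Unnormalised.Properties as ℚᵘP
  open import Data.Vec using (map)
  open SquaredDistance

  scale : ∀ {n} (K : ℕ) .{{_ : ℕ.NonZero K}} → Vec ℤ n → Vec ℚ n
  scale K = map (ℚ._/ K)

  toℚᵘ-/ : ∀ e k → toℚᵘ (e ℚ./ suc k) ℚᵘ.≃ mkℚᵘ e k
  toℚᵘ-/ e k = ℚP.toℚᵘ-fromℚᵘ (mkℚᵘ e k)

  toℚᵘ-toℚ : ∀ x → toℚᵘ (toℚ x) ℚᵘ.≃ mkℚᵘ (bit x) 0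
  toℚᵘ-toℚ true  = ℚᵘP.≃-refl
  toℚᵘ-toℚ false = ℚᵘP.≃-refl

  module _ (k : ℕ) where

    private
      K = suc k

    square-term : ∀ x e → toℚᵘ ((toℚ x ℚ.- e ℚ./ K) ℚ.* (toℚ x ℚ.- e ℚ./ K))
                          ℚᵘ.≃ (+ K * bit x - e) * (+ K * bit x - e) ℚᵘ./ (K ℕ.* K)
    square-term x e = ℚᵘP.≃-trans (ℚP.toℚᵘ-homo-* d d) (ℚᵘP.≃-trans (ℚᵘP.*-cong d≃ d≃) (*≡* cross))
      where
      d = toℚ x ℚ.- e ℚ./ K
      d≃ : toℚᵘ d ℚᵘ.≃ mkℚᵘ (bit x) 0 ℚᵘ.+ ℚᵘ.- mkℚᵘ e k
      d≃ = ℚᵘP.≃-trans (ℚP.toℚᵘ-homo-+ (toℚ x) (ℚ.- (e ℚ./ K)))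
             (ℚᵘP.+-cong (toℚᵘ-toℚ x) (ℚᵘP.≃-trans (ℚP.toℚᵘ-homo‿- (e ℚ./ K)) (ℚᵘP.-‿cong (toℚᵘ-/ e k))))
      cross : (bit x * + K + (- e) * + 1) * (bit x * + K + (- e) * + 1) * + (K ℕ.* K)
              ≡ (+ K * bit x - e) * (+ K * bit x - e) * + ((1 ℕ.* K) ℕ.* (1 ℕ.* K))
      cross = begin
        (bit x * + K + (- e) * + 1) * (bit x * + K + (- e) * + 1) * + (K ℕ.* K)
          ≡⟨ cong (λ q → (bit x * + K + (- e) * + 1) * (bit x * + K + (- e) * + 1) * q) (ℤP.pos-* K K) ⟩
        (bit x * + K + (- e) * + 1) * (bit x * + K + (- e) * + 1) * (+ K * + K)
          ≡⟨ regroup (bit x) e (+ K) ⟩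
        (+ K * bit x - e) * (+ K * bit x - e) * (+ 1 * + K * (+ 1 * + K))
          ≡⟨ cong (λ q → (+ K * bit x - e) * (+ K * bit x - e) * q)
               (sym (trans (ℤP.pos-* (1 ℕ.* K) (1 ℕ.* K)) (cong₂ _*_ (ℤP.pos-* 1 K) (ℤP.pos-* 1 K)))) ⟩
        (+ K * bit x - e) * (+ K * bit x - e) * + ((1 ℕ.* K) ℕ.* (1 ℕ.* K)) ∎
        where
        open ≡-Reasoning
        regroup : ∀ b e K → (b * K + (- e) * + 1) * (b * K + (- e) * + 1) * (K * K)
                  ≡ (K * b - e) * (K * b - e) * (+ 1 * K * (+ 1 * K))
        regroup = solve-∀

    +-same-denominator : ∀ a c → a ℚᵘ./ (K ℕ.* K) ℚᵘ.+ c ℚᵘ./ (K ℕ.* K) ℚᵘ.≃ (a + c) ℚᵘ./ (K ℕ.* K)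
    +-same-denominator a c = *≡* (begin
      (a * D + c * D) * D   ≡⟨ regroup a c D ⟩
      (a + c) * (D * D)     ≡⟨ cong ((a + c) *_) (sym (ℤP.pos-* (K ℕ.* K) (K ℕ.* K))) ⟩
      (a + c) * + ((K ℕ.* K) ℕ.* (K ℕ.* K)) ∎)
      where
      open ≡-Reasoning
      D = + (K ℕ.* K)
      regroup : ∀ a c d → (a * d + c * d) * d ≡ (a + c) * (d * d)
      regroup = solve-∀

    toℚᵘ-dist²-scale : ∀ {n} (X : Vec Bool n) e →
      toℚᵘ (dist² (embed X) (scale K e)) ℚᵘ.≃ sqDist (+ K) X e ℚᵘ./ (K ℕ.* K)
    toℚᵘ-dist²-scale []      []       = *≡* refl
    toℚᵘ-dist²-scale (x ∷ X) (e ∷ es) =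
      ℚᵘP.≃-trans (ℚP.toℚᵘ-homo-+ ((toℚ x ℚ.- e ℚ./ K) ℚ.* (toℚ x ℚ.- e ℚ./ K)) (dist² (embed X) (scale K es)))
        (ℚᵘP.≃-trans (ℚᵘP.+-cong (square-term x e) (toℚᵘ-dist²-scale X es))
          (+-same-denominator ((+ K * bit x - e) * (+ K * bit x - e)) (sqDist (+ K) X es)))

  dist²-scale-< : ∀ {n} K .{{_ : ℕ.NonZero K}} (X : Vec Bool n) e e′ →
    sqDist (+ K) X e ℤ.< sqDist (+ K) X e′ → dist² (embed X) (scale K e) ℚ.< dist² (embed X) (scale K e′)
  dist²-scale-< (suc k) X e e′ lt = ℚP.toℚᵘ-cancel-<
    (ℚᵘP.<-respʳ-≃ (ℚᵘP.≃-sym (toℚᵘ-dist²-scale k X e′))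
      (ℚᵘP.<-respˡ-≃ (ℚᵘP.≃-sym (toℚᵘ-dist²-scale k X e)) (*<* (ℤP.*-monoʳ-<-pos (+ (suc k ℕ.* suc k)) lt))))

module Resolution where

  open import Data.Nat using (_+_; _*_; _≤_; _<_; _^_; _∸_; ⌈_/2⌉; ⌊_/2⌋)
  open import Data.Nat.Logarithm using (⌈log₂_⌉; ⌈log₂⌉-mono-≤; ⌈log₂2^n⌉≡n; ⌈log₂⌈n/2⌉⌉≡⌈log₂n⌉∸1)
  open import Data.Nat.Induction using (<-rec)
  open import Data.Nat.Tactic.RingSolver using (solve-∀)
  open import Data.Nat.GCD using (gcd; gcd[m,n]≢0)
  open import Data.Integer as ℤ using (+_; ∣_∣)
  import Data.Integer.Properties as ℤP
  open import Data.Rational as ℚ using (ℚ; ↥_; ↧ₙ_)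
  import Data.Rational.Properties as ℚP

  ⌈log₂⌉-≤ : ∀ {x} R → x ≤ 2 ^ R → ⌈log₂ x ⌉ ≤ R
  ⌈log₂⌉-≤ R x≤ = subst (_ ≤_) (⌈log₂2^n⌉≡n R) (⌈log₂⌉-mono-≤ x≤)

  ≤-2^⌈log₂⌉ : ∀ n → n ≤ 2 ^ ⌈log₂ n ⌉
  ≤-2^⌈log₂⌉ = <-rec (λ n → n ≤ 2 ^ ⌈log₂ n ⌉) helper
    where
    helper : ∀ n → (∀ {m} → m < n → m ≤ 2 ^ ⌈log₂ m ⌉) → n ≤ 2 ^ ⌈log₂ n ⌉
    helper zero          _  = z≤n
    helper (suc zero)    _  = ℕP.m^n>0 2 ⌈log₂ 1 ⌉
    helper n@(suc (suc m)) ih = begin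
      n                              ≡⟨ sym (ℕP.⌊n/2⌋+⌈n/2⌉≡n n) ⟩
      ⌊ n /2⌋ + ⌈ n /2⌉              ≤⟨ ℕP.+-monoˡ-≤ ⌈ n /2⌉ (ℕP.⌊n/2⌋≤⌈n/2⌉ n) ⟩
      ⌈ n /2⌉ + ⌈ n /2⌉              ≤⟨ ℕP.+-mono-≤ half≤ half≤ ⟩
      2 ^ (L ∸ 1) + 2 ^ (L ∸ 1)      ≡⟨ cong (λ x → 2 ^ (L ∸ 1) + x) (sym (ℕP.+-identityʳ _)) ⟩
      2 ^ suc (L ∸ 1)                ≡⟨ cong (2 ^_) (ℕP.m+[n∸m]≡n 1≤L) ⟩
      2 ^ L                          ∎
      where
      open ℕP.≤-Reasoning
      L = ⌈log₂ n ⌉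
      half≤ : ⌈ n /2⌉ ≤ 2 ^ (L ∸ 1)
      half≤ = subst (λ e → ⌈ n /2⌉ ≤ 2 ^ e) (⌈log₂⌈n/2⌉⌉≡⌈log₂n⌉∸1 n) (ih (s≤s (ℕP.⌊n/2⌋<n m)))
      1≤L : 1 ≤ L
      1≤L = ⌈log₂⌉-mono-≤ {2} {n} (s≤s (s≤s z≤n))

  -- Normalising e / K only divides numerator and denominator by their gcd.
  RES-/-≤ : ∀ e K .{{_ : ℕ.NonZero K}} R → ∣ e ∣ < 2 ^ R → K < 2 ^ R → RES (e ℚ./ K) ≤ R
  RES-/-≤ e K@(suc _) R e< K< = ℕP.⊔-lub (⌈log₂⌉-≤ R numerator≤) (⌈log₂⌉-≤ R denominator≤)
    where
    g = gcd ∣ e ∣ K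
    instance
      g≢0 : ℕ.NonZero g
      g≢0 = ℕ.≢-nonZero (gcd[m,n]≢0 ∣ e ∣ K (inj₂ λ ()))
    ↥*g : ∣ ↥ (e ℚ./ K) ∣ ℕ.* g ≡ ∣ e ∣
    ↥*g = trans (sym (ℤP.abs-* (↥ (e ℚ./ K)) (+ g))) (cong ∣_∣ (ℚP.↥-/ e K))
    ↧*g : ↧ₙ (e ℚ./ K) ℕ.* g ≡ K
    ↧*g = ℤP.+-injective (trans (ℤP.pos-* (↧ₙ (e ℚ./ K)) g) (ℚP.↧-/ e K))
    numerator≤ : ∣ ↥ (e ℚ./ K) ℤ.+ ℤ.1ℤ ∣ ≤ 2 ^ R
    numerator≤ = ℕP.≤-trans (ℤP.∣i+j∣≤∣i∣+∣j∣ (↥ (e ℚ./ K)) ℤ.1ℤ)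
      (subst (_≤ 2 ^ R) (ℕP.+-comm 1 _)
        (ℕP.≤-trans (s≤s (ℕP.≤-trans (ℕP.m≤m*n _ g) (ℕP.≤-reflexive ↥*g))) e<))
    denominator≤ : suc (↧ₙ (e ℚ./ K)) ≤ 2 ^ R
    denominator≤ = ℕP.≤-trans (s≤s (ℕP.≤-trans (ℕP.m≤m*n _ g) (ℕP.≤-reflexive ↧*g))) K<

  cube-bound : ∀ {n P} → n < P → suc (n + (n * n + n * n * n)) ≤ P ^ 3
  cube-bound {n} n<P = ℕP.≤-trans (ℕP.≤-trans (ℕP.m≤m+n _ (2 * (n * n) + 2 * n)) (ℕP.≤-reflexive (expand n)))
                                  (ℕP.^-monoˡ-≤ 3 n<P)
    where
    expand : ∀ n → suc (n + (n * n + n * n * n)) + (2 * (n * n) + 2 * n) ≡ suc n * (suc n * (suc n * 1))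
    expand = solve-∀

  square-bound : ∀ {b} L → b ≤ (2 ^ suc L) ^ 3 → 32 * (b * b) ≤ 2 ^ (11 * L + 11)
  square-bound {b} L b≤ = begin
    32 * (b * b)                 ≤⟨ ℕP.*-monoʳ-≤ 32 (ℕP.*-mono-≤ b≤2^E b≤2^E) ⟩
    2 ^ 5 * (2 ^ E * 2 ^ E)      ≡⟨ cong (2 ^ 5 *_) (sym (ℕP.^-distribˡ-+-* 2 E E)) ⟩
    2 ^ 5 * 2 ^ (E + E)          ≡⟨ sym (ℕP.^-distribˡ-+-* 2 5 (E + E)) ⟩
    2 ^ (5 + (E + E))            ≤⟨ ℕP.^-monoʳ-≤ 2 (ℕP.≤-reflexive (exponent L)) ⟩
    2 ^ (6 * L + 11)             ≤⟨ ℕP.^-monoʳ-≤ 2 (ℕP.+-monoˡ-≤ 11 (ℕP.*-monoˡ-≤ L (ℕP.m≤m+n 6 5))) ⟩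
    2 ^ (11 * L + 11)            ∎
    where
    open ℕP.≤-Reasoning
    E = suc L * 3
    b≤2^E : b ≤ 2 ^ E
    b≤2^E = subst (b ≤_) (ℕP.^-*-assoc 2 (suc L) 3) b≤
    exponent : ∀ L → 5 + (suc L * 3 + suc L * 3) ≡ 6 * L + 11
    exponent = solve-∀

module Construction {n : ℕ} (f : BoolFun n) (f-symmetric : Symmetric f) where

  open import Data.Nat using (_^_)
  open import Data.Nat.Logarithm using (⌈log₂_⌉)
  open import Data.Rational as ℚ using (ℚ)
  import Data.Rational.Properties as ℚP
  open import Data.Vec using (lookup)
  import Data.Vec.Properties as VecP
  import Data.Bool.Properties as BoolP

  g : ℕ → Bool
  g k = f (onesFirst n k)

  B : ℕ
  B = n ℕ.+ (n ℕ.* n ℕ.+ n ℕ.* n ℕ.* n)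

  open Intervals g
  open Anchors B
  open Scaling
  open Resolution

  anchor : ℕ → Vec ℚ n
  anchor a = scale K (anchorℤ n (changeSum a) (changes g a))

  startsWith : Bool → List ℕ
  startsWith v = filter (λ a → g a Bool.≟ v) (starts n)

  anchors : Bool → List (Vec ℚ n)
  anchors v = List.map anchor (startsWith v)

  g-weight : ∀ X → g (weight X) ≡ f X
  g-weight X = f-symmetric (onesFirst n (weight X)) X (weight-onesFirst (weight-≤ X))

  nearer-anchor : ∀ X {b} → b ℕ.≤ n → changes g b ≢ changes g (weight X) →
                  dist² (embed X) (anchor (weight X)) ℚ.< dist² (embed X) (anchor b)
  nearer-anchor X {b} b≤n ι≢ = dist²-scale-< K X _ _
    (nearer X (ℕP.m≤n+m _ n) (admissible (weight-≤ X)) (admissible b≤n) (proj₂ (minimal (weight X) b) ι≢))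

  -- The input 1ᵃ0ⁿ⁻ᵃ is strictly nearer to the anchor of a than to that of any other start.
  anchor-injective : ∀ {a b} → a ∈ starts n → b ∈ starts n → anchor a ≡ anchor b → a ≡ b
  anchor-injective {a} {b} a∈ b∈ eq with a ℕ.≟ b
  ... | yes a≡b = a≡b
  ... | no  a≢b = ⊥-elim (ℚP.<-irrefl (cong (dist² (embed X)) (trans (cong anchor w≡a) eq))
                    (nearer-anchor X (starts-≤ n b∈) ι≢))
    where
    X = onesFirst n a
    w≡a : weight X ≡ a
    w≡a = weight-onesFirst (starts-≤ n a∈)
    ι≢ : changes g b ≢ changes g (weight X)
    ι≢ ι≡ = a≢b (sym (changes-injective-starts n b∈ a∈ (trans ι≡ (cong (changes g) w≡a))))

  closest : ∀ v X → f X ≡ v →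
            ∃[ p ] (p ∈ anchors v × (∀ q → q ∈ anchors (Bool.not v) → dist² (embed X) p ℚ.< dist² (embed X) q))
  closest v X fX≡v with interval-start (weight-≤ X)
  ... | a , a∈ , ι≡ , S≡ , g≡ =
    anchor a , ∈P.∈-map⁺ anchor (∈P.∈-filter⁺ _ a∈ (trans g≡ (trans (g-weight X) fX≡v))) , beats
    where
    same-anchor : anchor a ≡ anchor (weight X)
    same-anchor = cong₂ (λ s i → scale K (anchorℤ n s i)) S≡ ι≡
    beats : ∀ q → q ∈ anchors (Bool.not v) → dist² (embed X) (anchor a) ℚ.< dist² (embed X) q
    beats q q∈ with ∈P.∈-map∘filter⁻ anchor _ q∈
    ... | b , b∈ , refl , gb≡ = subst (λ p → dist² (embed X) p ℚ.< dist² (embed X) (anchor b))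
      (sym same-anchor) (nearer-anchor X (starts-≤ n b∈) other-interval)
      where
      other-interval : changes g b ≢ changes g (weight X)
      other-interval ι≡′ = BoolP.not-¬ refl
        (trans (sym (trans (changes≡⇒g≡ b (weight X) ι≡′) (trans (g-weight X) fX≡v))) gb≡)

  anchors-unique : ∀ v → Unique (anchors v)
  anchors-unique v = Unique-map⁺-on anchor
    (λ a∈ b∈ → anchor-injective (proj₁ (∈P.∈-filter⁻ _ a∈)) (proj₁ (∈P.∈-filter⁻ _ b∈)))
    (UniqueP.filter⁺ _ (starts-unique n))

  representation : NNRep f (anchors true) (anchors false)
  representation = record
    { uniqueP  = anchors-unique true
    ; uniqueN  = anchors-unique false
    ; disjoint = disjoint
    ; pos      = closest true
    ; neg      = closest false
    }
    where
    disjoint : ∀ {p} → p ∈ anchors true → p ∉ anchors false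
    disjoint p∈P p∈N with ∈P.∈-map∘filter⁻ anchor _ p∈P | ∈P.∈-map∘filter⁻ anchor _ p∈N
    ... | a , a∈ , refl , ga≡ | b , b∈ , eq , gb≡ with anchor-injective a∈ b∈ eq
    ... | refl = BoolP.not-¬ refl (trans (sym ga≡) gb≡)

  anchor-count : length (anchors true) ℕ.+ length (anchors false) ≡ I f
  anchor-count = begin
    length (anchors true) ℕ.+ length (anchors false)
      ≡⟨ cong₂ ℕ._+_ (ListP.length-map anchor (startsWith true)) (ListP.length-map anchor (startsWith false)) ⟩
    length (startsWith true) ℕ.+ length (startsWith false)
      ≡⟨ length-filter-true+false g (starts n) ⟩
    length (starts n)
      ≡⟨ length-starts n ⟩
    I f ∎
    where open ≡-Reasoning

  anchors-resolution : ∀ v → RESBound (anchors v) (11 ℕ.* ⌈log₂ n ⌉ ℕ.+ 11)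
  anchors-resolution v p∈ j with ∈P.∈-map∘filter⁻ anchor _ p∈
  ... | a , a∈ , refl , _ = subst (λ r → RES r ℕ.≤ 11 ℕ.* L ℕ.+ 11) (sym (VecP.lookup-map j (ℚ._/ K) e))
    (RES-/-≤ (lookup e j) K (11 ℕ.* L ℕ.+ 11)
      (ℕP.<-≤-trans (∣anchorℤ∣<32b² (admissible (starts-≤ n a∈)) (ℕP.m≤n+m _ n) (ℕP.m≤m+n n _) j) 32b²≤)
      (ℕP.<-≤-trans K<32b² 32b²≤))
    where
    e = anchorℤ n (changeSum a) (changes g a)
    L = ⌈log₂ n ⌉
    32b²≤ : 32 ℕ.* (suc B ℕ.* suc B) ℕ.≤ 2 ^ (11 ℕ.* L ℕ.+ 11)
    32b²≤ = square-bound L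
      (cube-bound (ℕP.≤-<-trans (≤-2^⌈log₂⌉ n) (ℕP.^-monoʳ-< 2 (s≤s (s≤s z≤n)) (ℕP.n<1+n L))))

open import Data.Nat using (_+_; _*_)
open import Data.Nat.Logarithm using (⌈log₂_⌉)

corollary1 : ∃[ C ] ∀ (n : ℕ) (f : BoolFun n) → Symmetric f →
    ∃[ P ] ∃[ N ] (NNRep f P N × length P + length N ≡ I f
    × RESBound P (C * ⌈log₂ n ⌉ + C) × RESBound N (C * ⌈log₂ n ⌉ + C))
corollary1 = 11 , λ n f f-symmetric → let open Construction f f-symmetric in
  anchors true , anchors false , representation , anchor-count , anchors-resolution true , anchors-resolution false
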